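{- Let $F_1,F_2$ be forests on the node set $[n]$, let $F_1^1$ be the forest obtained from $F_1$ by Step 1, and let $\textsc{ALG}(2)$ be the number of cut operations performed by Step 2 on $F_1^1$. Then $\textsc{ALG}(2)\le 2\tilde d(F_1^1,F_2)$.
   Context: Nodes are labelled by distinct labels from $[n]$ and identified with them; $p_F(u)$ is the parent of $u$ in $F$, $\bot$ if $u$ is a root. For the current forest $F$ (playing the role of the first forest), let $a[i]=p_F(i)$ if this is not $\bot$ and $a[i]=0$ otherwise, and $b[i]=p_{F_2}(i)$ if not $\bot$ and $0$ otherwise. Step 1 (applied to $F_1$): for every $i$ with $a[i],b[i]\neq0$ and $a[i]\neq b[i]$, remove the edges from $a[i]$ and from $b[i]$ to their parents in $F_1$ (if any), making them roots; the result is $F_1^1$. Step 2 (applied to $F_1^1$): for each $u\in[n]$ with children $v_1,\dots,v_k$ in $F_1^1$, let $B(u)$ be the multiset $\{b[v_i] : b[v_i]\neq0\}$ and let $\mathsf{mode}(B(u))$ be an element of largest multiplicity (ties broken arbitrarily); remove every edge $(v_i,u)$ with $b[v_i]\neq0$ and $b[v_i]\neq\mathsf{mode}(B(u))$. Operations: (cut) removing an edge from a node to its parent; (permutation) apply a permutation $\pi$ of $[n]$, so $\pi(u)$ becomes a child of $\pi(v)$ whenever $u$ was a child of $v$. The size of a sequence is the number of cuts plus the sum over permutations $\pi$ of $|\{x:\pi(x)\neq x\}|$. Write $F\sim F'$ if for every $u$: $p_F(u)=p_{F'}(u)$ or $p_F(u)=\bot$ or $p_{F'}(u)=\bot$. $\tilde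 d(F,F_2)$ is the minimum size of a sequence of cut and permutation operations transforming $F$ into some $F'$ with $F'\sim F_2$. -}

module Defs where

open import Data.Nat using (ℕ; zero; suc; _+_; _≤_)
open import Data.Bool using (Bool; true; false; not; _∧_; _∨_; if_then_else_)
open import Data.Fin using (Fin; zero; suc; _≟_)
open import Data.Maybe using (Maybe; just; nothing; _>>=_; map)
open import Data.Product using (∃-syntax; _×_)
open import Data.Sum using (_⊎_)
open import Data.Fin.Permutation using (Permutation′; _⟨$⟩ʳ_; _⟨$⟩ˡ_)
open import Relation.Nullary.Decidable using (⌊_⌋)
open import Relation.Binary.PropositionalEquality using (_≡_)

-- A parent map on the node set [n] (nodes = Fin n); nothing = ⊥ (root).
Par : ℕ → Set
Par n = Fin n → Maybe (Fin n)

anc : ∀ {n} → Par n → ℕ → Fin n → Maybe (Fin n)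
anc p zero    u = just u
anc p (suc k) u = anc p k u >>= p

-- A parent map is a forest iff it is acyclic: every node reaches ⊥ by
-- following parent pointers finitely often.
IsForest : ∀ {n} → Par n → Set
IsForest {n} p = ∀ (u : Fin n) → ∃[ k ] anc p k u ≡ nothing

countF : ∀ {n} → (Fin n → Bool) → ℕ
countF {zero}  f = 0
countF {suc n} f = (if f zero then 1 else 0) + countF (λ i → f (suc i))

anyF : ∀ {n} → (Fin n → Bool) → Bool
anyF {zero}  f = false
anyF {suc n} f = f zero ∨ anyF (λ i → f (suc i))

_==_ : ∀ {n} → Fin n → Fin n → Bool
x == y = ⌊ x ≟ y ⌋

isJust≡ : ∀ {n} → Maybe (Fin n) → Fin n → Bool
isJust≡ (just y) x = y == x
isJust≡ nothing  x = false

-- Step 1.  a = F (first forest), b = G (= F₂).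
-- u is made a root iff u = a[i] or u = b[i] for some i with a[i], b[i]
-- both defined and different.

step1Cond : ∀ {n} → Par n → Par n → Fin n → Fin n → Bool
step1Cond F G u i with F i | G i
... | just x | just y = not (x == y) ∧ ((x == u) ∨ (y == u))
... | _      | _      = false

step1 : ∀ {n} → Par n → Par n → Par n
step1 F G u = if anyF (step1Cond F G u) then nothing else F u

-- multiplicity of w in B(u) = {b[v] : v child of u in H, b[v] ≠ 0}
mult : ∀ {n} → Par n → Par n → Fin n → Fin n → ℕ
mult H G u w = countF (λ v → isJust≡ (H v) u ∧ isJust≡ (G v) w)

IsMode : ∀ {n} → Par n → Par n → Fin n → Fin n → Set
IsMode {n} H G u w =
  (∃[ v ] (H v ≡ just u × G v ≡ just w)) × (∀ (w' : Fin n) → mult H G u w' ≤ mult H G u w)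

-- A choice of mode for every node u (used only where B(u) is nonempty).
IsModeChoice : ∀ {n} → Par n → Par n → (Fin n → Fin n) → Set
IsModeChoice {n} H G md =
  ∀ (u : Fin n) → (∃[ v ] (H v ≡ just u × ∃[ w ] G v ≡ just w)) → IsMode H G u (md u)

step2Cut : ∀ {n} → Par n → Par n → (Fin n → Fin n) → Fin n → Bool
step2Cut H G md v with H v | G v
... | just u | just w = not (w == md u)
... | _      | _      = false

alg2 : ∀ {n} → Par n → Par n → (Fin n → Fin n) → ℕ
alg2 H G md = countF (step2Cut H G md)

cutAt : ∀ {n} → Par n → Fin n → Par n
cutAt F v x = if x == v then nothing else F x

-- π(u) becomes a child of π(w) whenever u was a child of w
permuteF : ∀ {n} → Permutation′ n → Par n → Par n
permuteF π F x = map (π ⟨$⟩ʳ_) (F (π ⟨$⟩ˡ x))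

moved : ∀ {n} → Permutation′ n → ℕ
moved π = countF (λ x → not ((π ⟨$⟩ʳ x) == x))

data Reach {n : ℕ} : Par n → Par n → ℕ → Set where
  done : ∀ {F F'} → (∀ x → F x ≡ F' x) → Reach F F' 0
  cut  : ∀ {F F' s} (v w : Fin n) → F v ≡ just w →
         Reach (cutAt F v) F' s → Reach F F' (suc s)
  perm : ∀ {F F' s} (π : Permutation′ n) →
         Reach (permuteF π F) F' s → Reach F F' (moved π + s)

_∼_ : ∀ {n} → Par n → Par n → Set
_∼_ {n} F F' = ∀ (u : Fin n) → F u ≡ F' u ⊎ F u ≡ nothing ⊎ F' u ≡ nothing

module Submission where

-- Let disagree u w be
-- the number of children of u with b-label defined and different from w;
-- then ALG(2) = Σᵤ disagree u (mode u), and the mode minimises disagree u.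
--
-- Consider a sequence of operations of size k turning H into F' ∼ F₂, and
-- let σ be the composition of its permutations.  Throughout, the current
-- forest is the σ-relabelling of a subforest of H.  For every node u, each
-- child v of u counted in disagree u (σ u) is, at the end, either moved by σ
-- or has lost its H-edge: otherwise its final parent σ u would contradict
-- F' ∼ F₂.  Hence Σᵤ disagree u (σ u) ≤ (lost H-edges) + (nodes moved by σ),
-- and this potential grows by at most 1 per cut and at most |moved π| per
-- permutation π.  So ALG(2) ≤ k ≤ 2k.

open import Defs
open import Data.Nat using (ℕ; _*_; _≤_)
open import Data.Fin using (Fin)

open import Data.Nat using (zero; suc; _+_; z≤n; s≤s)
open import Data.Nat.Properties
  using (≤-refl; ≤-trans; +-mono-≤; +-monoˡ-≤; +-monoʳ-≤; +-cancelˡ-≤; +-identityʳ; +-assoc; +-suc; m≤n*m; module ≤-Reasoning)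
open import Data.Bool using (Bool; true; false; not; _∧_; _∨_; if_then_else_)
open import Data.Bool.Properties using (∧-assoc)
open import Data.Fin using (zero; suc; _≟_)
open import Data.Fin.Properties using (suc-injective)
open import Data.Fin.Permutation using (Permutation′; _⟨$⟩ʳ_; _∘ₚ_; inverseˡ)
import Data.Fin.Permutation as Perm
open import Data.Maybe using (Maybe; just; nothing; maybe′; is-just; is-nothing)
import Data.Maybe as Maybe
open import Data.Maybe.Properties using (map-∘; just-injective)
open import Data.Product using (∃-syntax; _×_; _,_; proj₂)
open import Data.Sum using (_⊎_; inj₁; inj₂)
open import Data.Empty using (⊥-elim)
open import Relation.Nullary using (yes; no; ¬_)
open import Relation.Nullary.Decidable using (isYes≗does; dec-true; dec-false; ⌊⌋-map′)
open import Relation.Binary.PropositionalEquality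
open import Algebra.Properties.CommutativeMonoid.Sum Data.Nat.Properties.+-0-commutativeMonoid
  using (sum; ∑-comm; ∑-permute; ∑-distrib-+; sum-cong-≗)

==-refl : ∀ {n} (x : Fin n) → (x == x) ≡ true
==-refl x = trans (isYes≗does (x ≟ x)) (dec-true (x ≟ x) refl)

==-false : ∀ {n} {x y : Fin n} → x ≢ y → (x == y) ≡ false
==-false {x = x} {y} x≢y = trans (isYes≗does (x ≟ y)) (dec-false (x ≟ y) x≢y)

==-sound : ∀ {n} {x y : Fin n} → (x == y) ≡ true → x ≡ y
==-sound {x = x} {y} e with x ≟ y
... | yes x≡y = x≡y
==-sound () | no _

isJust≡-sound : ∀ {n} (m : Maybe (Fin n)) u → isJust≡ m u ≡ true → m ≡ just u
isJust≡-sound (just y) u e = cong just (==-sound e)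

==-sym : ∀ {n} (x y : Fin n) → (x == y) ≡ (y == x)
==-sym x y with x ≟ y
... | yes refl = sym (==-refl x)
... | no x≢y = sym (==-false (λ y≡x → x≢y (sym y≡x)))

==-suc : ∀ {n} (x y : Fin n) → (Fin.suc x == suc y) ≡ (x == y)
==-suc x y = ⌊⌋-map′ (cong suc) suc-injective (x ≟ y)

∧-intro : ∀ {a b} → a ≡ true → b ≡ true → (a ∧ b) ≡ true
∧-intro refl refl = refl

∧-elimˡ : ∀ a {b} → (a ∧ b) ≡ true → a ≡ true
∧-elimˡ true _ = refl

∧-elimʳ : ∀ a {b} → (a ∧ b) ≡ true → b ≡ true
∧-elimʳ true e = e

∨-introˡ : ∀ {a} b → a ≡ true → (a ∨ b) ≡ true
∨-introˡ b refl = refl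

∨-introʳ : ∀ a {b} → b ≡ true → (a ∨ b) ≡ true
∨-introʳ false refl = refl
∨-introʳ true refl = refl

-- Counting.  countF is the sum of the 0/1 indicators, which gives access to
-- the summation lemmas of the library.

𝟙 : Bool → ℕ
𝟙 b = if b then 1 else 0

countF≡sum : ∀ {n} (f : Fin n → Bool) → countF f ≡ sum (λ i → 𝟙 (f i))
countF≡sum {zero} f = refl
countF≡sum {suc n} f = cong (𝟙 (f zero) +_) (countF≡sum (λ i → f (suc i)))

countF-cong : ∀ {n} {f g : Fin n → Bool} → (∀ i → f i ≡ g i) → countF f ≡ countF g
countF-cong {zero} e = refl
countF-cong {suc n} e = cong₂ _+_ (cong 𝟙 (e zero)) (countF-cong (λ i → e (suc i)))

countF-false : ∀ {n} → countF {n} (λ _ → false) ≡ 0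
countF-false {zero} = refl
countF-false {suc n} = countF-false {n}

sum-mono : ∀ {n} {f g : Fin n → ℕ} → (∀ i → f i ≤ g i) → sum f ≤ sum g
sum-mono {zero} le = z≤n
sum-mono {suc n} le = +-mono-≤ (le zero) (sum-mono (λ i → le (suc i)))

countF-mono : ∀ {n} {f g : Fin n → Bool} → (∀ i → f i ≡ true → g i ≡ true) → countF f ≤ countF g
countF-mono {f = f} {g} imp = begin
  countF f                ≡⟨ countF≡sum f ⟩
  sum (λ i → 𝟙 (f i))     ≤⟨ sum-mono (λ i → 𝟙-mono (imp i)) ⟩
  sum (λ i → 𝟙 (g i))     ≡⟨ countF≡sum g ⟨
  countF g                ∎
  where
  open ≤-Reasoning
  𝟙-mono : ∀ {a b} → (a ≡ true → b ≡ true) → 𝟙 a ≤ 𝟙 b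
  𝟙-mono {false} _ = z≤n
  𝟙-mono {true} imp rewrite imp refl = ≤-refl

countF-∨ : ∀ {n} (f g : Fin n → Bool) → countF (λ i → f i ∨ g i) ≤ countF f + countF g
countF-∨ f g = begin
  countF (λ i → f i ∨ g i)              ≡⟨ countF≡sum (λ i → f i ∨ g i) ⟩
  sum (λ i → 𝟙 (f i ∨ g i))             ≤⟨ sum-mono (λ i → 𝟙-∨ (f i) (g i)) ⟩
  sum (λ i → 𝟙 (f i) + 𝟙 (g i))         ≡⟨ ∑-distrib-+ (λ i → 𝟙 (f i)) (λ i → 𝟙 (g i)) ⟩
  sum (λ i → 𝟙 (f i)) + sum (λ i → 𝟙 (g i))
    ≡⟨ cong₂ _+_ (countF≡sum f) (countF≡sum g) ⟨
  countF f + countF g                   ∎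
  where
  open ≤-Reasoning
  𝟙-∨ : ∀ a b → 𝟙 (a ∨ b) ≤ 𝟙 a + 𝟙 b
  𝟙-∨ false b = ≤-refl
  𝟙-∨ true b = s≤s z≤n

countF-split : ∀ {n} (f g : Fin n → Bool) →
  countF f ≡ countF (λ i → f i ∧ g i) + countF (λ i → f i ∧ not (g i))
countF-split f g = begin
  countF f                              ≡⟨ countF≡sum f ⟩
  sum (λ i → 𝟙 (f i))                   ≡⟨ sum-cong-≗ (λ i → 𝟙-split (f i) (g i)) ⟩
  sum (λ i → 𝟙 (f i ∧ g i) + 𝟙 (f i ∧ not (g i)))
    ≡⟨ ∑-distrib-+ (λ i → 𝟙 (f i ∧ g i)) (λ i → 𝟙 (f i ∧ not (g i))) ⟩
  sum (λ i → 𝟙 (f i ∧ g i)) + sum (λ i → 𝟙 (f i ∧ not (g i)))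
    ≡⟨ cong₂ _+_ (countF≡sum (λ i → f i ∧ g i)) (countF≡sum (λ i → f i ∧ not (g i))) ⟨
  countF (λ i → f i ∧ g i) + countF (λ i → f i ∧ not (g i)) ∎
  where
  open ≡-Reasoning
  𝟙-split : ∀ a b → 𝟙 a ≡ 𝟙 (a ∧ b) + 𝟙 (a ∧ not b)
  𝟙-split false b = refl
  𝟙-split true false = refl
  𝟙-split true true = refl

countF-witness : ∀ {n} (f : Fin n → Bool) → countF f ≡ 0 ⊎ ∃[ i ] f i ≡ true
countF-witness {zero} f = inj₁ refl
countF-witness {suc n} f with f zero in f0
... | true = inj₂ (zero , f0)
... | false with countF-witness (λ i → f (suc i))
...   | inj₁ none = inj₁ none
...   | inj₂ (i , fi) = inj₂ (suc i , fi)

countF-permute : ∀ {n} (σ : Permutation′ n) (f : Fin n → Bool) →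
  countF (λ x → f (σ ⟨$⟩ʳ x)) ≡ countF f
countF-permute σ f = begin
  countF (λ x → f (σ ⟨$⟩ʳ x))    ≡⟨ countF≡sum (λ x → f (σ ⟨$⟩ʳ x)) ⟩
  sum (λ x → 𝟙 (f (σ ⟨$⟩ʳ x)))   ≡⟨ ∑-permute (λ y → 𝟙 (f y)) σ ⟨
  sum (λ y → 𝟙 (f y))            ≡⟨ countF≡sum f ⟨
  countF f                       ∎
  where open ≡-Reasoning

countF-point : ∀ {n} (y : Fin n) (h : Fin n → Bool) → countF (λ u → (y == u) ∧ h u) ≡ 𝟙 (h y)
countF-point {suc n} zero h = trans (cong (𝟙 (h zero) +_) (countF-false {n})) (+-identityʳ _)
countF-point {suc n} (suc y) h = begin
  countF (λ u → (suc y == suc u) ∧ h (suc u)) ≡⟨ countF-cong (λ u → cong (_∧ h (suc u)) (==-suc y u)) ⟩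
  countF (λ u → (y == u) ∧ h (suc u))         ≡⟨ countF-point y (λ u → h (suc u)) ⟩
  𝟙 (h (suc y))                               ∎
  where open ≡-Reasoning

countF-preimage : ∀ {n} (σ : Permutation′ n) (v : Fin n) → countF (λ x → (σ ⟨$⟩ʳ x) == v) ≡ 1
countF-preimage σ v = begin
  countF (λ x → (σ ⟨$⟩ʳ x) == v)  ≡⟨ countF-permute σ (_== v) ⟩
  countF (λ y → y == v)           ≡⟨ countF-cong (λ y → trans (==-sym y v) (sym (∧-true (v == y)))) ⟩
  countF (λ y → (v == y) ∧ true)  ≡⟨ countF-point v (λ _ → true) ⟩
  1                               ∎
  where
  open ≡-Reasoning
  ∧-true : ∀ b → (b ∧ true) ≡ b
  ∧-true false = refl
  ∧-true true = refl

displaced : ∀ {n} → Permutation′ n → Fin n → Bool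
displaced σ x = not ((σ ⟨$⟩ʳ x) == x)

moved-∘ₚ : ∀ {n} (σ π : Permutation′ n) → moved (σ ∘ₚ π) ≤ moved σ + moved π
moved-∘ₚ σ π = begin
  moved (σ ∘ₚ π)                                      ≤⟨ countF-mono displaced-∘ₚ ⟩
  countF (λ x → displaced σ x ∨ displaced π (σ ⟨$⟩ʳ x)) ≤⟨ countF-∨ (displaced σ) (λ x → displaced π (σ ⟨$⟩ʳ x)) ⟩
  moved σ + countF (λ x → displaced π (σ ⟨$⟩ʳ x))      ≡⟨ cong (moved σ +_) (countF-permute σ (displaced π)) ⟩
  moved σ + moved π                                    ∎
  where
  open ≤-Reasoning
  displaced-∘ₚ : ∀ x → displaced (σ ∘ₚ π) x ≡ true → (displaced σ x ∨ displaced π (σ ⟨$⟩ʳ x)) ≡ true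
  displaced-∘ₚ x moved-x with (σ ⟨$⟩ʳ x) ≟ x
  ... | no _ = refl
  ... | yes σx≡x = subst (λ z → not ((π ⟨$⟩ʳ (σ ⟨$⟩ʳ x)) == z) ≡ true) (sym σx≡x) moved-x

-- Double counting by parents: summing over u the number of v with parent u
-- satisfying p u v counts every node v once, at its parent.

countF-byParent : ∀ {n} (m : Par n) (p : Fin n → Fin n → Bool) →
  sum (λ u → countF (λ v → isJust≡ (m v) u ∧ p u v)) ≡ countF (λ v → maybe′ (λ u → p u v) false (m v))
countF-byParent m p = begin
  sum (λ u → countF (λ v → isJust≡ (m v) u ∧ p u v))
    ≡⟨ sum-cong-≗ (λ u → countF≡sum (λ v → isJust≡ (m v) u ∧ p u v)) ⟩
  sum (λ u → sum (λ v → 𝟙 (isJust≡ (m v) u ∧ p u v)))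
    ≡⟨ ∑-comm (λ u v → 𝟙 (isJust≡ (m v) u ∧ p u v)) ⟩
  sum (λ v → sum (λ u → 𝟙 (isJust≡ (m v) u ∧ p u v)))
    ≡⟨ sum-cong-≗ (λ v → atParent (m v) (λ u → p u v)) ⟩
  sum (λ v → 𝟙 (maybe′ (λ u → p u v) false (m v)))
    ≡⟨ countF≡sum (λ v → maybe′ (λ u → p u v) false (m v)) ⟨
  countF (λ v → maybe′ (λ u → p u v) false (m v)) ∎
  where
  open ≡-Reasoning
  atParent : ∀ {n} (mv : Maybe (Fin n)) (h : Fin n → Bool) →
    sum (λ u → 𝟙 (isJust≡ mv u ∧ h u)) ≡ 𝟙 (maybe′ h false mv)
  atParent {n} nothing h = trans (sym (countF≡sum {n} (λ _ → false))) (countF-false {n})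
  atParent (just y) h = trans (sym (countF≡sum (λ u → (y == u) ∧ h u))) (countF-point y h)

module Step2 {n : ℕ} (H G : Par n) where

  differs : Maybe (Fin n) → Fin n → Bool
  differs m w = maybe′ (λ y → not (y == w)) false m

  differs-sound : ∀ m w → differs m w ≡ true → ∃[ y ] (m ≡ just y × y ≢ w)
  differs-sound (just y) w y≠w = y , refl , λ { refl → false≢true (trans (cong not (sym (==-refl y))) y≠w) }
    where
    false≢true : ¬ (false ≡ true)
    false≢true ()

  disagree : Fin n → Fin n → ℕ
  disagree u w = countF (λ v → isJust≡ (H v) u ∧ differs (G v) w)

  labelled : Fin n → ℕ
  labelled u = countF (λ v → isJust≡ (H v) u ∧ is-just (G v))

  labelled-split : ∀ u w → labelled u ≡ mult H G u w + disagree u w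
  labelled-split u w = trans (countF-split (λ v → isJust≡ (H v) u ∧ is-just (G v)) (λ v → isJust≡ (G v) w))
    (cong₂ _+_ (countF-cong (λ v → trans (∧-assoc (isJust≡ (H v) u) _ _) (cong (isJust≡ (H v) u ∧_) (agree (G v)))))
               (countF-cong (λ v → trans (∧-assoc (isJust≡ (H v) u) _ _) (cong (isJust≡ (H v) u ∧_) (disagrees (G v))))))
    where
    agree : ∀ m → (is-just m ∧ isJust≡ m w) ≡ isJust≡ m w
    agree (just y) = refl
    agree nothing = refl
    disagrees : ∀ m → (is-just m ∧ not (isJust≡ m w)) ≡ differs m w
    disagrees (just y) = refl
    disagrees nothing = refl

  maxMult-minimises : ∀ u w → (∀ w' → mult H G u w' ≤ mult H G u w) → ∀ w' → disagree u w ≤ disagree u w'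
  maxMult-minimises u w max w' = +-cancelˡ-≤ (mult H G u w') (disagree u w) (disagree u w') (begin
    mult H G u w' + disagree u w ≤⟨ +-monoˡ-≤ (disagree u w) (max w') ⟩
    mult H G u w + disagree u w  ≡⟨ labelled-split u w ⟨
    labelled u                   ≡⟨ labelled-split u w' ⟩
    mult H G u w' + disagree u w' ∎)
    where open ≤-Reasoning

  -- the chosen mode minimises disagreements (trivially when there are none)
  modeChoice-minimises : ∀ md → IsModeChoice H G md → ∀ u w' → disagree u (md u) ≤ disagree u w'
  modeChoice-minimises md isMode u w' with countF-witness (λ v → isJust≡ (H v) u ∧ differs (G v) (md u))
  ... | inj₁ none rewrite none = z≤n
  ... | inj₂ (v , dv) with differs-sound (G v) (md u) (∧-elimʳ (isJust≡ (H v) u) dv)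
  ...   | y , Gv≡y , _ =
    maxMult-minimises u (md u) (proj₂ (isMode u (v , isJust≡-sound (H v) u (∧-elimˡ _ dv) , y , Gv≡y))) w'

  alg2-byParent : ∀ md → alg2 H G md ≡ sum (λ u → disagree u (md u))
  alg2-byParent md = begin
    alg2 H G md ≡⟨ countF-cong step2Cut-atParent ⟩
    countF (λ v → maybe′ (λ u → differs (G v) (md u)) false (H v))
      ≡⟨ countF-byParent H (λ u v → differs (G v) (md u)) ⟨
    sum (λ u → disagree u (md u)) ∎
    where
    open ≡-Reasoning
    step2Cut-atParent : ∀ v → step2Cut H G md v ≡ maybe′ (λ u → differs (G v) (md u)) false (H v)
    step2Cut-atParent v with H v | G v
    ... | just u  | just w  = refl
    ... | just u  | nothing = refl
    ... | nothing | just w  = refl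
    ... | nothing | nothing = refl

∼-resp-≗ : ∀ {n} {C F' G : Par n} → (∀ x → C x ≡ F' x) → F' ∼ G → C ∼ G
∼-resp-≗ C≗F' F'∼G u rewrite C≗F' u = F'∼G u

-- A sequence of operations applied to H.  Along the sequence we track the
-- composition σ of the permutations performed; the current forest C stays
-- the σ-relabelling of a subforest of H.

module Operations {n : ℕ} (H : Par n) where

  Embeds : Par n → Permutation′ n → Set
  Embeds C σ = ∀ x → C (σ ⟨$⟩ʳ x) ≡ nothing ⊎ C (σ ⟨$⟩ʳ x) ≡ Maybe.map (σ ⟨$⟩ʳ_) (H x)

  lost : Par n → Permutation′ n → Fin n → Bool
  lost C σ x = is-just (H x) ∧ is-nothing (C (σ ⟨$⟩ʳ x))

  -- lost H-edges plus nodes moved so far: at most the size spent so far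
  potential : Par n → Permutation′ n → ℕ
  potential C σ = countF (lost C σ) + moved σ

  embeds-start : Embeds H Perm.id
  embeds-start x with H x
  ... | just _  = inj₂ refl
  ... | nothing = inj₁ refl

  potential-start : potential H Perm.id ≡ 0
  potential-start = cong₂ _+_
    (trans (countF-cong nothing-lost) (countF-false {n}))
    (trans (countF-cong {n} (λ x → cong not (==-refl x))) (countF-false {n}))
    where
    nothing-lost : ∀ x → lost H Perm.id x ≡ false
    nothing-lost x with H x
    ... | just _  = refl
    ... | nothing = refl

  embeds-cut : ∀ C σ v → Embeds C σ → Embeds (cutAt C v) σ
  embeds-cut C σ v emb x with (σ ⟨$⟩ʳ x) == v
  ... | true  = inj₁ refl
  ... | false = emb x

  -- a cut loses at most one H-edge: the one of the σ-preimage of v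
  potential-cut : ∀ C σ v → potential (cutAt C v) σ ≤ suc (potential C σ)
  potential-cut C σ v = +-monoˡ-≤ (moved σ) (begin
    countF (lost (cutAt C v) σ)                                  ≤⟨ countF-mono lost-cut ⟩
    countF (λ x → lost C σ x ∨ ((σ ⟨$⟩ʳ x) == v))                ≤⟨ countF-∨ (lost C σ) (λ x → (σ ⟨$⟩ʳ x) == v) ⟩
    countF (lost C σ) + countF (λ x → (σ ⟨$⟩ʳ x) == v)           ≡⟨ cong (countF (lost C σ) +_) (countF-preimage σ v) ⟩
    countF (lost C σ) + 1                                        ≡⟨ +-suc _ 0 ⟩
    suc (countF (lost C σ) + 0)                                  ≡⟨ cong suc (+-identityʳ _) ⟩
    suc (countF (lost C σ))                                      ∎)
    where
    open ≤-Reasoning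
    lost-cut : ∀ x → lost (cutAt C v) σ x ≡ true → (lost C σ x ∨ ((σ ⟨$⟩ʳ x) == v)) ≡ true
    lost-cut x lost-x with (σ ⟨$⟩ʳ x) == v
    ... | true  = ∨-introʳ (lost C σ x) refl
    ... | false = ∨-introˡ false lost-x

  embeds-perm : ∀ C σ π → Embeds C σ → Embeds (permuteF π C) (σ ∘ₚ π)
  embeds-perm C σ π emb x rewrite inverseˡ π {σ ⟨$⟩ʳ x} with emb x
  ... | inj₁ root   rewrite root   = inj₁ refl
  ... | inj₂ parent rewrite parent = inj₂ (sym (map-∘ (H x)))

  -- a permutation loses no edge and moves at most |moved π| further nodes
  potential-perm : ∀ C σ π → potential (permuteF π C) (σ ∘ₚ π) ≤ potential C σ + moved π
  potential-perm C σ π = begin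
    countF (lost (permuteF π C) (σ ∘ₚ π)) + moved (σ ∘ₚ π) ≡⟨ cong (_+ moved (σ ∘ₚ π)) (countF-cong same-lost) ⟩
    countF (lost C σ) + moved (σ ∘ₚ π)                     ≤⟨ +-monoʳ-≤ (countF (lost C σ)) (moved-∘ₚ σ π) ⟩
    countF (lost C σ) + (moved σ + moved π)                ≡⟨ +-assoc (countF (lost C σ)) (moved σ) (moved π) ⟨
    potential C σ + moved π                                ∎
    where
    open ≤-Reasoning
    same-lost : ∀ x → lost (permuteF π C) (σ ∘ₚ π) x ≡ lost C σ x
    same-lost x rewrite inverseˡ π {σ ⟨$⟩ʳ x} with C (σ ⟨$⟩ʳ x)
    ... | just _  = refl
    ... | nothing = refl

module Comparison {n : ℕ} (H G : Par n) where
  open Step2 H G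
  open Operations H

  -- A child v of u whose b-label w is not σ u, at the end of a sequence
  -- ending ∼ G, has been moved or has lost its edge: if σ fixes v and the
  -- edge survives, then C v = just (σ u), contradicting C ∼ G.
  lost-or-displaced : ∀ C σ → Embeds C σ → C ∼ G → ∀ u v w →
    H v ≡ just u → G v ≡ just w → w ≢ σ ⟨$⟩ʳ u → (lost C σ v ∨ displaced σ v) ≡ true
  lost-or-displaced C σ emb C∼G u v w Hv≡u Gv≡w w≢σu with (σ ⟨$⟩ʳ v) ≟ v
  ... | no _ = ∨-introʳ (lost C σ v) refl
  ... | yes σv≡v with emb v
  ...   | inj₁ root   rewrite Hv≡u | root = refl
  ...   | inj₂ parent = ⊥-elim (incompatible (C∼G v))
    where
    Cv≡σu : C v ≡ just (σ ⟨$⟩ʳ u)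
    Cv≡σu = trans (cong C (sym σv≡v)) (trans parent (cong (Maybe.map (σ ⟨$⟩ʳ_)) Hv≡u))
    incompatible : ¬ (C v ≡ G v ⊎ C v ≡ nothing ⊎ G v ≡ nothing)
    incompatible (inj₁ same) = w≢σu (sym (just-injective (trans (sym Cv≡σu) (trans same Gv≡w))))
    incompatible (inj₂ (inj₁ root)) with trans (sym Cv≡σu) root
    ... | ()
    incompatible (inj₂ (inj₂ unlabelled)) with trans (sym Gv≡w) unlabelled
    ... | ()

  disagreement-bound : ∀ C σ → Embeds C σ → C ∼ G → sum (λ u → disagree u (σ ⟨$⟩ʳ u)) ≤ potential C σ
  disagreement-bound C σ emb C∼G = begin
    sum (λ u → disagree u (σ ⟨$⟩ʳ u))                ≤⟨ sum-mono (λ u → countF-mono (paid u)) ⟩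
    sum (λ u → countF (λ v → isJust≡ (H v) u ∧ R v)) ≡⟨ countF-byParent H (λ _ v → R v) ⟩
    countF (λ v → maybe′ (λ _ → R v) false (H v))    ≤⟨ countF-mono (λ v → ignoreParent (H v)) ⟩
    countF R                                         ≤⟨ countF-∨ (lost C σ) (displaced σ) ⟩
    potential C σ                                    ∎
    where
    open ≤-Reasoning
    R : Fin n → Bool
    R v = lost C σ v ∨ displaced σ v
    paid : ∀ u v → (isJust≡ (H v) u ∧ differs (G v) (σ ⟨$⟩ʳ u)) ≡ true → (isJust≡ (H v) u ∧ R v) ≡ true
    paid u v child with differs-sound (G v) (σ ⟨$⟩ʳ u) (∧-elimʳ (isJust≡ (H v) u) child)
    ... | w , Gv≡w , w≢σu = ∧-intro (∧-elimˡ _ child)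
      (lost-or-displaced C σ emb C∼G u v w (isJust≡-sound (H v) u (∧-elimˡ _ child)) Gv≡w w≢σu)
    ignoreParent : ∀ {b} (m : Maybe (Fin n)) → maybe′ (λ _ → b) false m ≡ true → b ≡ true
    ignoreParent (just _) e = e

  module _ (md : Fin n → Fin n) (isMode : IsModeChoice H G md) where

    alg2-≤-potential : ∀ C σ → Embeds C σ → C ∼ G → alg2 H G md ≤ potential C σ
    alg2-≤-potential C σ emb C∼G = begin
      alg2 H G md                         ≡⟨ alg2-byParent md ⟩
      sum (λ u → disagree u (md u))       ≤⟨ sum-mono (λ u → modeChoice-minimises md isMode u (σ ⟨$⟩ʳ u)) ⟩
      sum (λ u → disagree u (σ ⟨$⟩ʳ u))   ≤⟨ disagreement-bound C σ emb C∼G ⟩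
      potential C σ                       ∎
      where open ≤-Reasoning

    alg2-≤-reach : ∀ {C F' s} → Reach C F' s → ∀ σ → Embeds C σ → F' ∼ G →
      alg2 H G md ≤ potential C σ + s
    alg2-≤-reach {C} (done C≗F') σ emb F'∼G = begin
      alg2 H G md     ≤⟨ alg2-≤-potential C σ emb (∼-resp-≗ C≗F' F'∼G) ⟩
      potential C σ   ≡⟨ +-identityʳ _ ⟨
      potential C σ + 0 ∎
      where open ≤-Reasoning
    alg2-≤-reach {C} {s = suc s} (cut v _ _ rest) σ emb F'∼G = begin
      alg2 H G md                         ≤⟨ alg2-≤-reach rest σ (embeds-cut C σ v emb) F'∼G ⟩
      potential (cutAt C v) σ + s         ≤⟨ +-monoˡ-≤ s (potential-cut C σ v) ⟩
      suc (potential C σ) + s             ≡⟨ +-suc (potential C σ) s ⟨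
      potential C σ + suc s               ∎
      where open ≤-Reasoning
    alg2-≤-reach {C} (perm {s = s} π rest) σ emb F'∼G = begin
      alg2 H G md                                    ≤⟨ alg2-≤-reach rest (σ ∘ₚ π) (embeds-perm C σ π emb) F'∼G ⟩
      potential (permuteF π C) (σ ∘ₚ π) + s          ≤⟨ +-monoˡ-≤ s (potential-perm C σ π) ⟩
      potential C σ + moved π + s                    ≡⟨ +-assoc (potential C σ) (moved π) s ⟩
      potential C σ + (moved π + s)                  ∎
      where open ≤-Reasoning

    alg2-≤-distance : ∀ {F' k} → Reach H F' k → F' ∼ G → alg2 H G md ≤ k
    alg2-≤-distance {k = k} r F'∼G =
      subst (alg2 H G md ≤_) (cong (_+ k) potential-start) (alg2-≤-reach r Perm.id embeds-start F'∼G)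

lemma16 : ∀ (n : ℕ) (F₁ F₂ : Par n) → IsForest F₁ → IsForest F₂ →
    ∀ (md : Fin n → Fin n) → IsModeChoice (step1 F₁ F₂) F₂ md →
    ∀ (F' : Par n) (k : ℕ) → Reach (step1 F₁ F₂) F' k → F' ∼ F₂ →
    alg2 (step1 F₁ F₂) F₂ md ≤ 2 * k
lemma16 n F₁ F₂ _ _ md isMode F' k r F'∼F₂ =
  ≤-trans (Comparison.alg2-≤-distance (step1 F₁ F₂) F₂ md isMode r F'∼F₂) (m≤n*m k 2)
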